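{- Let $\Gamma$ be a finite connected simple graph and let $\Sigma$ be a motif of $\Gamma$ with vertices $p_1,\dots,p_m$. Suppose $1$ is an eigenvalue of (the normalized Laplacian of) $\Sigma$, regarded as a graph on its own, with eigenfunction $f^\Sigma_1$. Let $\Gamma^\Sigma$ be obtained from $\Gamma$ by adding new vertices $q_1,\dots,q_m$, joining $q_\alpha$ and $q_\beta$ by an edge whenever $p_\alpha$ and $p_\beta$ are joined by an edge, and joining each $q_\alpha$ with every vertex $p\notin\Sigma$ of $\Gamma$ that is a neighbor of $p_\alpha$ (no other edges are added). Then $1$ is an eigenvalue of the normalized Laplacian of $\Gamma^\Sigma$, with an eigenfunction that vanishes at all vertices other than $p_1,\dots,p_m,q_1,\dots,q_m$; namely the function equal to $f^\Sigma_1(p_\alpha)$ at $p_\alpha$, to $-f^\Sigma_1(p_\alpha)$ at $q_\alpha$, and to $0$ elsewhere.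
   Context: A motif of $\Gamma$ is a connected subgraph $\Sigma$ of $\Gamma$ containing all edges of $\Gamma$ between its vertices (a connected induced subgraph). For a finite graph without isolated vertices, with vertex degrees $n_i$, the normalized Laplacian is $\Delta v(i)=v(i)-\frac{1}{n_i}\sum_{j\sim i}v(j)$ on real functions $v$ on the vertices ($j\sim i$ means $j,i$ adjacent); an eigenfunction for $\lambda$ is a nonzero $u$ with $\Delta u=\lambda u$. In particular $u\not\equiv0$ is an eigenfunction for eigenvalue $1$ iff $\sum_{j\sim i}u(j)=0$ for all vertices $i$. -}

module Defs where

open import Level using (Level)
open import Data.Nat using (ℕ; zero; suc)
import Data.Nat as ℕ
open import Data.Fin using (Fin; zero; suc; _↑ˡ_; _↑ʳ_; splitAt; _≟_)
open import Data.Bool using (Bool; true; false; if_then_else_; _∧_; not)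
open import Data.Sum using (_⊎_; inj₁; inj₂)
open import Data.Maybe using (Maybe; just; nothing)
open import Data.Product using (∃; _×_)
open import Relation.Nullary using (¬_; yes; no)
open import Relation.Nullary.Decidable using (⌊_⌋)
open import Relation.Binary.PropositionalEquality using (_≡_; _≢_)
open import Function.Definitions using (Injective)
open import Algebra.Bundles using (CommutativeRing)

Adj : ℕ → Set
Adj n = Fin n → Fin n → Bool

IsSimple : ∀ {n} → Adj n → Set
IsSimple {n} A = (∀ i j → A i j ≡ A j i) × (∀ i → A i i ≡ false)

data Reach {n} (A : Adj n) : Fin n → Fin n → Set where
  here : ∀ {i} → Reach A i i
  step : ∀ {i k j} → A i k ≡ true → Reach A k j → Reach A i j

IsConnected : ∀ {n} → Adj n → Set
IsConnected {n} A = ∀ (i j : Fin n) → Reach A i j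

induced : ∀ {n m} → Adj n → (Fin m → Fin n) → Adj m
induced A p α β = A (p α) (p β)

IsMotif : ∀ {n m} → Adj n → (Fin m → Fin n) → Set
IsMotif A p = Injective _≡_ _≡_ p × IsConnected (induced A p)

module _ {c ℓ} (R : CommutativeRing c ℓ) where
  open CommutativeRing R using (Carrier; _≈_; _+_; -_; 0#)

  sumFin : ∀ k → (Fin k → Carrier) → Carrier
  sumFin zero    g = 0#
  sumFin (suc k) g = g zero + sumFin k (λ i → g (suc i))

  neighbourSum : ∀ {n} → Adj n → (Fin n → Carrier) → Fin n → Carrier
  neighbourSum {n} A u i = sumFin n (λ j → if A i j then u j else 0#)

  -- u is an eigenfunction of the normalized Laplacian for eigenvalue 1:
  -- u ≢ 0 and Σ_{j∼i} u(j) = 0 for every vertex i.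
  IsEigenfunction1 : ∀ {n} → Adj n → (Fin n → Carrier) → Set ℓ
  IsEigenfunction1 {n} A u =
    (∃ λ (i : Fin n) → ¬ (u i ≈ 0#)) × (∀ i → neighbourSum A u i ≈ 0#)

preimage : ∀ {n m} → (Fin m → Fin n) → Fin n → Maybe (Fin m)
preimage {m = zero}  p v = nothing
preimage {m = suc m} p v with p zero ≟ v
... | yes _ = just zero
... | no  _ = Data.Maybe.map suc (preimage (λ α → p (suc α)) v)
  where import Data.Maybe

inΣ : ∀ {n m} → (Fin m → Fin n) → Fin n → Bool
inΣ p v with preimage p v
... | just _  = true
... | nothing = false

-- The graph Γ^Σ on vertices Fin (n ℕ.+ m): old vertices v ↑ˡ m, new vertex q_α = n ↑ʳ α.
--  * old–old: edges of Γ;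
--  * q_α–q_β: iff p_α ∼ p_β;
--  * q_α–v (v old): iff v ∉ Σ and v ∼ p_α.
extAdj : ∀ {n m} → Adj n → (Fin m → Fin n) → Adj (n ℕ.+ m)
extAdj {n} {m} A p x y with splitAt n x | splitAt n y
... | inj₁ v | inj₁ w = A v w
... | inj₂ α | inj₂ β = A (p α) (p β)
... | inj₂ α | inj₁ w = not (inΣ p w) ∧ A (p α) w
... | inj₁ v | inj₂ β = not (inΣ p v) ∧ A (p β) v

module _ {c ℓ} (R : CommutativeRing c ℓ) where
  open CommutativeRing R using (Carrier; _≈_; _+_; -_; 0#)

  extFun : ∀ {n m} → (Fin m → Fin n) → (Fin m → Carrier) → Fin (n ℕ.+ m) → Carrier
  extFun {n} p f x with splitAt n x
  ... | inj₂ α = - f α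
  ... | inj₁ v with preimage p v
  ...   | just α  = f α
  ...   | nothing = 0#

-- Write u for the extended function and split the neighbours of every vertex of Γ^Σ into old
-- vertices and new vertices q_β.  At p_α the old neighbours carry exactly Σ_{β ∼ α} f(β), the
-- eigenvalue equation of Σ, and no q_β is adjacent to p_α.  At q_α the old neighbours lie outside
-- Σ, where u vanishes, and the new ones carry −Σ_{β ∼ α} f(β).  At an old vertex v ∉ Σ each
-- neighbour p_β, carrying f(β), is matched by the neighbour q_β carrying −f(β).
module Submission where

open import Defs
open import Data.Nat using (ℕ; _≤_; zero; suc)
import Data.Nat as ℕ
open import Data.Fin using (Fin; zero; suc; _↑ˡ_; _↑ʳ_; splitAt; join; _≟_)
open import Data.Fin.Properties using (splitAt-↑ˡ; splitAt-↑ʳ; join-splitAt; suc-injective)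
open import Data.Bool using (Bool; true; false; if_then_else_; _∧_; not)
open import Data.Sum using (inj₁; inj₂)
open import Data.Maybe using (just; nothing)
open import Data.Product using (_,_)
open import Data.Empty using (⊥-elim)
open import Function.Definitions using (Injective)
open import Relation.Nullary using (yes; no; does)
open import Relation.Nullary.Decidable using (dec-true; dec-false)
open import Relation.Binary.PropositionalEquality as ≡ using (_≡_; _≢_)
open import Algebra.Bundles using (CommutativeRing)
open CommutativeRing using (Carrier)

preimage-sound : ∀ {n m} (p : Fin m → Fin n) v {α} → preimage p v ≡ just α → p α ≡ v
preimage-sound {m = suc m} p v eq with p zero ≟ v
preimage-sound {m = suc m} p v ≡.refl | yes p0≡v = p0≡v
... | no _ with preimage (λ α → p (suc α)) v in e
preimage-sound {m = suc m} p v ≡.refl | no _ | just β = preimage-sound (λ α → p (suc α)) v e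

preimage-complete : ∀ {n m} (p : Fin m → Fin n) v → preimage p v ≡ nothing → ∀ α → p α ≢ v
preimage-complete {m = suc m} p v eq α with p zero ≟ v
preimage-complete {m = suc m} p v () α | yes _
... | no p0≢v with preimage (λ α → p (suc α)) v in e
preimage-complete {m = suc m} p v ≡.refl zero    | no p0≢v | nothing = p0≢v
preimage-complete {m = suc m} p v ≡.refl (suc α) | no p0≢v | nothing =
  preimage-complete (λ α → p (suc α)) v e α

preimage-injective : ∀ {n m} (p : Fin m → Fin n) → Injective _≡_ _≡_ p →
                     ∀ α → preimage p (p α) ≡ just α
preimage-injective p injective α with preimage p (p α) in e
... | just β  = ≡.cong just (injective (preimage-sound p (p α) e))
... | nothing = ⊥-elim (preimage-complete p (p α) e α ≡.refl)

module SumFinProperties {c ℓ} (R : CommutativeRing c ℓ) where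
  open CommutativeRing R hiding (zero; Carrier)
  open import Algebra.Properties.AbelianGroup +-abelianGroup using (ε⁻¹≈ε; ⁻¹-∙-comm)
  open import Algebra.Properties.CommutativeSemigroup +-commutativeSemigroup using (interchange)
  open import Relation.Binary.Reasoning.Setoid setoid

  ∑ : ∀ k → (Fin k → Carrier R) → Carrier R
  ∑ = sumFin R

  sumFin-cong : ∀ k {g h : Fin k → Carrier R} → (∀ i → g i ≈ h i) → ∑ k g ≈ ∑ k h
  sumFin-cong zero    g≈h = refl
  sumFin-cong (suc k) g≈h = +-cong (g≈h zero) (sumFin-cong k (λ i → g≈h (suc i)))

  sumFin-0 : ∀ k {g : Fin k → Carrier R} → (∀ i → g i ≈ 0#) → ∑ k g ≈ 0#
  sumFin-0 zero    g≈0 = refl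
  sumFin-0 (suc k) g≈0 = trans (+-cong (g≈0 zero) (sumFin-0 k (λ i → g≈0 (suc i)))) (+-identityˡ 0#)

  sumFin-+ : ∀ k (g h : Fin k → Carrier R) → ∑ k (λ i → g i + h i) ≈ ∑ k g + ∑ k h
  sumFin-+ zero    g h = sym (+-identityˡ 0#)
  sumFin-+ (suc k) g h = trans (+-cong refl (sumFin-+ k _ _)) (interchange _ _ _ _)

  sumFin-neg : ∀ k (g : Fin k → Carrier R) → ∑ k (λ i → - g i) ≈ - ∑ k g
  sumFin-neg zero    g = sym ε⁻¹≈ε
  sumFin-neg (suc k) g = trans (+-cong refl (sumFin-neg k _)) (⁻¹-∙-comm _ _)

  sumFin-comm : ∀ a b (F : Fin a → Fin b → Carrier R) →
                ∑ a (λ i → ∑ b (F i)) ≈ ∑ b (λ j → ∑ a (λ i → F i j))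
  sumFin-comm zero    b F = sym (sumFin-0 b (λ _ → refl))
  sumFin-comm (suc a) b F = trans (+-cong refl (sumFin-comm a b _)) (sym (sumFin-+ b _ _))

  sumFin-↑ : ∀ n m (g : Fin (n ℕ.+ m) → Carrier R) →
             ∑ (n ℕ.+ m) g ≈ ∑ n (λ v → g (v ↑ˡ m)) + ∑ m (λ α → g (n ↑ʳ α))
  sumFin-↑ zero    m g = sym (+-identityˡ _)
  sumFin-↑ (suc n) m g = trans (+-cong refl (sumFin-↑ n m _)) (sym (+-assoc _ _ _))

  sumFin-single : ∀ k (v : Fin k) (g : Fin k → Carrier R) → (∀ w → w ≢ v → g w ≈ 0#) → ∑ k g ≈ g v
  sumFin-single (suc k) zero    g g≈0 =
    trans (+-cong refl (sumFin-0 k (λ i → g≈0 (suc i) (λ ())))) (+-identityʳ _)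
  sumFin-single (suc k) (suc v) g g≈0 =
    trans (+-cong (g≈0 zero (λ ()))
                  (sumFin-single k v _ (λ w w≢v → g≈0 (suc w) (λ e → w≢v (suc-injective e)))))
          (+-identityˡ _)

  guard : Bool → Carrier R → Carrier R
  guard b x = if b then x else 0#

  guard-cong : ∀ b {x y} → x ≈ y → guard b x ≈ guard b y
  guard-cong true  x≈y = x≈y
  guard-cong false x≈y = refl

  guard-0 : ∀ b {x} → x ≈ 0# → guard b x ≈ 0#
  guard-0 true  x≈0 = x≈0
  guard-0 false x≈0 = refl

  guard-neg : ∀ b x → guard b (- x) ≈ - guard b x
  guard-neg true  x = refl
  guard-neg false x = sym ε⁻¹≈ε

  guard-inverse : ∀ b x → guard b x + guard b (- x) ≈ 0#
  guard-inverse true  x = -‿inverseʳ x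
  guard-inverse false x = +-identityˡ 0#

  guard-false : ∀ {b} x → b ≡ false → guard b x ≈ 0#
  guard-false x ≡.refl = refl

  -- The double sum of guard [p α = w] (g w) over α and w is evaluated in both orders.
  sumFin-image : ∀ {n m} (p : Fin m → Fin n) → Injective _≡_ _≡_ p →
                 (g : Fin n → Carrier R) → (∀ w → preimage p w ≡ nothing → g w ≈ 0#) →
                 ∑ n g ≈ ∑ m (λ α → g (p α))
  sumFin-image {n} {m} p injective g g≈0 = begin
    ∑ n g                               ≈⟨ sumFin-cong n g-as-sum ⟩
    ∑ n (λ w → ∑ m (λ α → δ α w))       ≈⟨ sumFin-comm n m _ ⟩
    ∑ m (λ α → ∑ n (δ α))               ≈⟨ sumFin-cong m (λ α → trans (sumFin-single n (p α) _ (δ-off α)) (δ-on α)) ⟩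
    ∑ m (λ α → g (p α))                 ∎
    where
    δ : Fin m → Fin n → Carrier R
    δ α w = guard (does (p α ≟ w)) (g w)

    δ-off : ∀ α w → w ≢ p α → δ α w ≈ 0#
    δ-off α w w≢pα = guard-false (g w) (dec-false (p α ≟ w) (λ e → w≢pα (≡.sym e)))

    δ-on : ∀ α → δ α (p α) ≈ g (p α)
    δ-on α rewrite dec-true (p α ≟ p α) ≡.refl = refl

    g-as-sum : ∀ w → g w ≈ ∑ m (λ α → δ α w)
    g-as-sum w with preimage p w in e
    ... | just α rewrite ≡.sym (preimage-sound p w e) = sym (begin
      ∑ m (λ β → δ β (p α)) ≈⟨ sumFin-single m α _ (λ β β≢α → δ-off β (p α) (λ e′ → β≢α (injective (≡.sym e′)))) ⟩
      δ α (p α)             ≈⟨ δ-on α ⟩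
      g (p α)               ∎)
    ... | nothing = trans (g≈0 w e)
                          (sym (sumFin-0 m (λ α → δ-off α w (λ e′ → preimage-complete p w e α (≡.sym e′)))))

module Extension {c ℓ} (R : CommutativeRing c ℓ) {n m : ℕ} (A : Adj n) (p : Fin m → Fin n)
                 (f : Fin m → Carrier R) where
  open CommutativeRing R hiding (zero; Carrier)
  open SumFinProperties R
  open import Algebra.Properties.AbelianGroup +-abelianGroup using (ε⁻¹≈ε)
  open import Relation.Binary.Reasoning.Setoid setoid

  u : Fin (n ℕ.+ m) → Carrier R
  u = extFun R p f

  extAdj-old-old : ∀ v w → extAdj A p (v ↑ˡ m) (w ↑ˡ m) ≡ A v w
  extAdj-old-old v w rewrite splitAt-↑ˡ n v m | splitAt-↑ˡ n w m = ≡.refl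

  extAdj-new-new : ∀ α β → extAdj A p (n ↑ʳ α) (n ↑ʳ β) ≡ A (p α) (p β)
  extAdj-new-new α β rewrite splitAt-↑ʳ n m α | splitAt-↑ʳ n m β = ≡.refl

  extAdj-new-old : ∀ α w → extAdj A p (n ↑ʳ α) (w ↑ˡ m) ≡ not (inΣ p w) ∧ A (p α) w
  extAdj-new-old α w rewrite splitAt-↑ʳ n m α | splitAt-↑ˡ n w m = ≡.refl

  extAdj-old-new : ∀ v β → extAdj A p (v ↑ˡ m) (n ↑ʳ β) ≡ not (inΣ p v) ∧ A (p β) v
  extAdj-old-new v β rewrite splitAt-↑ˡ n v m | splitAt-↑ʳ n m β = ≡.refl

  extFun-new : ∀ α → u (n ↑ʳ α) ≡ - f α
  extFun-new α rewrite splitAt-↑ʳ n m α = ≡.refl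

  extFun-outside : ∀ w → preimage p w ≡ nothing → u (w ↑ˡ m) ≡ 0#
  extFun-outside w e rewrite splitAt-↑ˡ n w m | e = ≡.refl

  extFun-image : Injective _≡_ _≡_ p → ∀ α → u (p α ↑ˡ m) ≡ f α
  extFun-image injective α rewrite splitAt-↑ˡ n (p α) m | preimage-injective p injective α = ≡.refl

  inΣ-image : Injective _≡_ _≡_ p → ∀ α → inΣ p (p α) ≡ true
  inΣ-image injective α rewrite preimage-injective p injective α = ≡.refl

  inΣ-outside : ∀ w → preimage p w ≡ nothing → inΣ p w ≡ false
  inΣ-outside w e rewrite e = ≡.refl

  nb : Fin (n ℕ.+ m) → Carrier R
  nb = neighbourSum R (extAdj A p) u

  nb-old-split : ∀ v → nb (v ↑ˡ m) ≈ ∑ n (λ w → guard (A v w) (u (w ↑ˡ m)))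
                             + ∑ m (λ β → guard (not (inΣ p v) ∧ A (p β) v) (- f β))
  nb-old-split v = trans (sumFin-↑ n m _)
    (+-cong (sumFin-cong n (λ w → reflexive (≡.cong (λ b → guard b _) (extAdj-old-old v w))))
            (sumFin-cong m (λ β → reflexive (≡.cong₂ guard (extAdj-old-new v β) (extFun-new β)))))

  nb-new-split : ∀ α → nb (n ↑ʳ α) ≈ ∑ n (λ w → guard (not (inΣ p w) ∧ A (p α) w) (u (w ↑ˡ m)))
                             + ∑ m (λ β → guard (A (p α) (p β)) (- f β))
  nb-new-split α = trans (sumFin-↑ n m _)
    (+-cong (sumFin-cong n (λ w → reflexive (≡.cong (λ b → guard b _) (extAdj-new-old α w))))
            (sumFin-cong m (λ β → reflexive (≡.cong₂ guard (extAdj-new-new α β) (extFun-new β)))))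

  module _ (injective : Injective _≡_ _≡_ p) where

    old-neighbours : ∀ v → ∑ n (λ w → guard (A v w) (u (w ↑ˡ m))) ≈ ∑ m (λ β → guard (A v (p β)) (f β))
    old-neighbours v =
      trans (sumFin-image p injective _ (λ w e → guard-0 (A v w) (reflexive (extFun-outside w e))))
            (sumFin-cong m (λ β → reflexive (≡.cong (guard (A v (p β))) (extFun-image injective β))))

    nb-outside≈0 : (∀ i j → A i j ≡ A j i) → ∀ v → preimage p v ≡ nothing → nb (v ↑ˡ m) ≈ 0#
    nb-outside≈0 symmetric v e = begin
      nb (v ↑ˡ m)
        ≈⟨ nb-old-split v ⟩
      _ ≈⟨ +-cong (old-neighbours v) (sumFin-cong m (λ β → reflexive
             (≡.cong (λ b → guard b (- f β)) (≡.cong₂ (λ b a → not b ∧ a) (inΣ-outside v e) (symmetric (p β) v))))) ⟩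
      ∑ m (λ β → guard (A v (p β)) (f β)) + ∑ m (λ β → guard (A v (p β)) (- f β))
        ≈⟨ sym (sumFin-+ m _ _) ⟩
      ∑ m (λ β → guard (A v (p β)) (f β) + guard (A v (p β)) (- f β))
        ≈⟨ sumFin-0 m (λ β → guard-inverse (A v (p β)) (f β)) ⟩
      0# ∎

    module _ (eigen : ∀ α → neighbourSum R (induced A p) f α ≈ 0#) where

      nb-image≈0 : ∀ α → nb (p α ↑ˡ m) ≈ 0#
      nb-image≈0 α = begin
        nb (p α ↑ˡ m)
          ≈⟨ nb-old-split (p α) ⟩
        _ ≈⟨ +-cong (old-neighbours (p α))
                    (sumFin-0 m (λ β → guard-false (- f β) (≡.cong (_∧ _) (≡.cong not (inΣ-image injective α))))) ⟩
        neighbourSum R (induced A p) f α + 0#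
          ≈⟨ +-identityʳ _ ⟩
        neighbourSum R (induced A p) f α
          ≈⟨ eigen α ⟩
        0# ∎

      nb-new≈0 : ∀ α → nb (n ↑ʳ α) ≈ 0#
      nb-new≈0 α = begin
        nb (n ↑ʳ α)
          ≈⟨ nb-new-split α ⟩
        _ ≈⟨ +-cong (sumFin-0 n outside-Σ) (sumFin-cong m (λ β → guard-neg (A (p α) (p β)) (f β))) ⟩
        0# + ∑ m (λ β → - guard (A (p α) (p β)) (f β))
          ≈⟨ +-identityˡ _ ⟩
        _ ≈⟨ sumFin-neg m _ ⟩
        - neighbourSum R (induced A p) f α
          ≈⟨ -‿cong (eigen α) ⟩
        - 0#
          ≈⟨ ε⁻¹≈ε ⟩
        0# ∎
        where
        outside-Σ : ∀ w → guard (not (inΣ p w) ∧ A (p α) w) (u (w ↑ˡ m)) ≈ 0#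
        outside-Σ w with preimage p w in e
        ... | just _  = guard-false (u (w ↑ˡ m)) ≡.refl
        ... | nothing = guard-0 _ (reflexive (extFun-outside w e))

      nb≈0 : (∀ i j → A i j ≡ A j i) → ∀ x → nb x ≈ 0#
      nb≈0 symmetric x = ≡.subst (λ y → nb y ≈ 0#) (join-splitAt n m x) (by-side (splitAt n x))
        where
        by-side : ∀ s → nb (join n m s) ≈ 0#
        by-side (inj₂ α) = nb-new≈0 α
        by-side (inj₁ v) with preimage p v in e
        ... | just α  rewrite ≡.sym (preimage-sound p v e) = nb-image≈0 α
        ... | nothing = nb-outside≈0 symmetric v e

mainTheorem2 : ∀ {c ℓ} (R : CommutativeRing c ℓ) (n m : ℕ) (A : Adj n) (p : Fin m → Fin n)
    → IsSimple A → IsConnected A → IsMotif A p → 2 ≤ m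
    → (f : Fin m → Carrier R) → IsEigenfunction1 R (induced A p) f
    → IsEigenfunction1 R (extAdj A p) (extFun R p f)
mainTheorem2 R n m A p (symmetric , _) _ (injective , _) _ f ((α , fα≉0) , eigen) =
  (p α ↑ˡ m , λ uα≈0 → fα≉0 (trans (reflexive (≡.sym (extFun-image injective α))) uα≈0))
  , nb≈0 injective eigen symmetric
  where
  open CommutativeRing R using (trans; reflexive)
  open Extension R A p f
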